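{- Let $k\geq 2$ be an integer and let $G=(V,E)$ be a hypergraph of rank $r$ with minimum degree $\delta(G)\geq 2rk^2$. Then $G$ has a $\frac{1}{k}$-majority $(k+1)$-edge-colouring.
   Context: A hypergraph $G=(V,E)$ consists of a finite vertex set $V$ and a collection $E$ of non-empty subsets of $V$ (hyperedges). The degree $d(v)$ of $v\in V$ is the number of hyperedges containing $v$; the minimum degree is $\delta(G)=\min_{v\in V} d(v)$; the rank of $G$ is $r=\max_{e\in E}|e|$. For an integer $k\geq 2$, a $\frac{1}{k}$-majority $(k+1)$-edge-colouring of $G$ is a map $c:E\to\{1,\dots,k+1\}$ such that for every vertex $v$ and every colour $i$, the number of hyperedges $e\ni v$ with $c(e)=i$ is at most $\lfloor d(v)/k\rfloor$. -}

module Defs where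

open import Data.Nat using (ℕ; zero; suc; _+_; _*_; _≤_; _⊔_; _/_)
open import Data.Fin using (Fin)
open import Data.Fin.Subset using (Subset; _∈_; ∣_∣; Nonempty)
open import Data.Fin.Subset.Properties using (_∈?_)
open import Data.Bool using (if_then_else_)
open import Relation.Nullary.Decidable using (does)
open import Relation.Binary.PropositionalEquality using (_≡_)
open import Data.Fin using (_≟_)

-- A hypergraph on vertex set Fin n with m hyperedges (a collection, so
-- repeated hyperedges are allowed), each a non-empty subset of Fin n.
record Hypergraph (n m : ℕ) : Set where
  field
    edge     : Fin m → Subset n
    nonempty : ∀ e → Nonempty (edge e)

open Hypergraph public

countFin : ∀ {m} → (Fin m → Data.Bool.Bool) → ℕ
countFin {zero}  p = 0
countFin {suc m} p = (if p Fin.zero then 1 else 0) + countFin (λ i → p (Fin.suc i))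
  where import Data.Fin as Fin

maxFin : ∀ {m} → (Fin m → ℕ) → ℕ
maxFin {zero}  f = 0
maxFin {suc m} f = f Fin.zero ⊔ maxFin (λ i → f (Fin.suc i))
  where import Data.Fin as Fin

degree : ∀ {n m} → Hypergraph n m → Fin n → ℕ
degree G v = countFin (λ e → does (v ∈? edge G e))

rank : ∀ {n m} → Hypergraph n m → ℕ
rank G = maxFin (λ e → ∣ edge G e ∣)

MinDegreeAtLeast : ∀ {n m} → Hypergraph n m → ℕ → Set
MinDegreeAtLeast G d = ∀ v → d ≤ degree G v

colourDegree : ∀ {n m c} → Hypergraph n m → (Fin m → Fin c) → Fin n → Fin c → ℕ
colourDegree G col v i =
  countFin (λ e → does (v ∈? edge G e) Data.Bool.∧ does (col e ≟ i))

IsMajorityColouring : ∀ {n m} (k : ℕ) .{{_ : Data.Nat.NonZero k}} →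
  Hypergraph n m → (Fin m → Fin (suc k)) → Set
IsMajorityColouring k G col =
  ∀ v i → colourDegree G col v i ≤ degree G v / k

-- Iterated rounding in the style of Beck and Fiala.  Start from the uniform fractional
-- colouring, in which every edge gives weight 1/(k+1) to every colour, and keep weights
-- x (e, i) ∈ [0, 1] with row sums 1.  The support of (v, i), the number of edges at v giving
-- colour i positive weight, is its load ∑_{e ∋ v} x (e, i) plus its deficit, the sum of
-- 1 − x (e, i) over the fractional entries; call (v, i) frozen when its deficit exceeds the
-- rank r.  Fix every integral entry, the sum of every row containing a fractional entry, and
-- the load of every frozen pair.  As each edge has at most r vertices,
--   r · #frozen ≤ ∑ deficits ≤ r · ∑ (1 − x) = r · (#fractional entries − #fractional rows),
-- the first inequality being strict unless nothing is frozen, in which case the right-hand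
-- side is positive.  So there are fewer constraints than entries, and moving along a nonzero
-- solution of the homogeneous system until some entry reaches 0 or 1 makes one more entry
-- integral.  Supports never grow, and an unfrozen pair has support at most load + r, so the
-- invariant "load ≤ initial load, or support ≤ initial load + r" survives every step.  In the
-- end every colour class at v has at most d(v)/(k+1) + r edges, which is at most ⌊d(v)/k⌋
-- once d(v) ≥ 2rk².

module Submission where

open import Algebra.Bundles using (Ring)
open import Data.Bool using (Bool; true; false; if_then_else_; T; not; _∧_)
open import Data.Fin as Fin using (Fin; zero; suc; punchIn; combine; remQuot; _↑ˡ_; _↑ʳ_)
open import Data.Fin.Properties using (any?)
import Data.Fin.Properties as Fin
open import Data.Fin.Subset using (Subset; inside; outside; ∣_∣)
open import Data.Fin.Subset.Properties using (_∈?_)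
open import Data.List using (List; []; _∷_; length; map; filter; allFin; _++_)
import Data.List.Extrema
open import Data.List.Membership.Propositional.Properties using (∈-filter⁺; ∈-allFin)
import Data.List.Properties as List
open import Data.List.Relation.Unary.All as All using (All; []; _∷_)
import Data.List.Relation.Unary.All.Properties as All
open import Data.Nat as ℕ using (ℕ; zero; suc)
open import Data.Nat.DivMod using (m*n/n≡m; /-monoˡ-≤)
open import Data.Nat.Induction using (<-wellFounded)
import Data.Nat.Properties as ℕ
import Data.Nat.Solver
open import Data.Product using (Σ; ∃; _×_; _,_; proj₁; proj₂; uncurry)
open import Data.Rational
  using (ℚ; 0ℚ; 1ℚ; _+_; _*_; -_; _-_; _≤_; _<_; 1/_; NonZero; ≢-nonZero; >-nonZero; positive; nonNegative; nonPositive)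
import Data.Rational.Properties as ℚ
open import Data.Rational.Solver using (module +-*-Solver)
open import Data.Sum using (_⊎_; inj₁; inj₂)
open import Data.Unit using (tt)
open import Data.Vec using ([]; _∷_)
open import Data.Vec.Functional using (insertAt; removeAt)
import Data.Vec.Functional.Properties as Vector
open import Function using (_∘_; id)
open import Induction.WellFounded using (Acc; acc)
open import Relation.Binary using (tri<; tri≈; tri>; DecTotalOrder)
open import Relation.Binary.PropositionalEquality
open import Relation.Nullary using (Dec; ¬_; yes; no; does; contradiction)
open import Relation.Nullary.Decidable using (dec-true; dec-false; ¬?; decidable-stable; _×-dec_)

open import Defs

open import Algebra.Properties.Semiring.Sum (Ring.semiring ℚ.+-*-ring)
  using (sum; sum-syntax; sum-cong-≗; sum-remove; sum-replicate; sum-replicate-zero;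
         ∑-distrib-+; ∑-comm; *-distribˡ-sum; *-distribʳ-sum)
open import Algebra.Properties.Semiring.Mult (Ring.semiring ℚ.+-*-ring)
  using (×-homo-+; ×1-homo-*; ×-assoc-*) renaming (_×_ to _ℕ×_)

fromℕ : ℕ → ℚ
fromℕ n = n ℕ× 1ℚ

𝟙 : Bool → ℚ
𝟙 b = if b then 1ℚ else 0ℚ

does⇒ : ∀ {A : Set} (d : Dec A) → T (does d) → A
does⇒ (yes a) _ = a

⇒does : ∀ {A : Set} (d : Dec A) → A → T (does d)
⇒does (yes _) _ = tt
⇒does (no ¬a) a = ¬a a

T-∧-monoʳ : ∀ a {b c} → (T b → T c) → T (a ∧ b) → T (a ∧ c)
T-∧-monoʳ true b⇒c = b⇒c

<⇒≱ : ∀ {a b} → a < b → ¬ b ≤ a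
<⇒≱ a<b b≤a = ℚ.<-irrefl refl (ℚ.<-≤-trans a<b b≤a)

0≤1 : 0ℚ ≤ 1ℚ
0≤1 = ℚ.<⇒≤ (ℚ.positive⁻¹ 1ℚ)

0<1-y : ∀ {y} → y < 1ℚ → 0ℚ < 1ℚ - y
0<1-y {y} y<1 = subst (_< 1ℚ - y) (ℚ.+-inverseʳ y) (ℚ.+-monoˡ-< (- y) y<1)

0<* : ∀ {a b} → 0ℚ < a → 0ℚ < b → 0ℚ < a * b
0<* {a} {b} 0<a 0<b = ℚ.positive⁻¹ _ {{ℚ.pos*pos⇒pos a {{positive 0<a}} b {{positive 0<b}}}}

0≤* : ∀ {a b} → 0ℚ ≤ a → 0ℚ ≤ b → 0ℚ ≤ a * b
0≤* {a} {b} 0≤a 0≤b = ℚ.nonNegative⁻¹ _ {{ℚ.nonNeg*nonNeg⇒nonNeg a {{nonNegative 0≤a}} b {{nonNegative 0≤b}}}}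

0<1/ : ∀ {c} (0<c : 0ℚ < c) → 0ℚ < (1/ c) {{>-nonZero 0<c}}
0<1/ {c} 0<c = ℚ.positive⁻¹ _ {{ℚ.1/pos⇒pos c {{positive 0<c}}}}

+*0 : ∀ y t → y + t * 0ℚ ≡ y
+*0 y t = trans (cong (y +_) (ℚ.*-zeroʳ t)) (ℚ.+-identityʳ y)

fromℕ-nonNeg : ∀ n → 0ℚ ≤ fromℕ n
fromℕ-nonNeg zero    = ℚ.≤-refl
fromℕ-nonNeg (suc n) = ℚ.+-mono-≤ 0≤1 (fromℕ-nonNeg n)

fromℕ-suc-pos : ∀ n → 0ℚ < fromℕ (suc n)
fromℕ-suc-pos n = ℚ.+-mono-<-≤ (ℚ.positive⁻¹ 1ℚ) (fromℕ-nonNeg n)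

fromℕ-mono-≤ : ∀ {a b} → a ℕ.≤ b → fromℕ a ≤ fromℕ b
fromℕ-mono-≤ {b = b} ℕ.z≤n = fromℕ-nonNeg b
fromℕ-mono-≤ (ℕ.s≤s a≤b)   = ℚ.+-monoʳ-≤ 1ℚ (fromℕ-mono-≤ a≤b)

fromℕ-mono-< : ∀ {a b} → a ℕ.< b → fromℕ a < fromℕ b
fromℕ-mono-< {a} a<b = ℚ.<-≤-trans a<1+a (fromℕ-mono-≤ a<b)
  where
  a<1+a : fromℕ a < 1ℚ + fromℕ a
  a<1+a = subst (_< 1ℚ + fromℕ a) (ℚ.+-identityˡ (fromℕ a)) (ℚ.+-monoˡ-< (fromℕ a) (ℚ.positive⁻¹ 1ℚ))

fromℕ-cancel-≤ : ∀ {a b} → fromℕ a ≤ fromℕ b → a ℕ.≤ b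
fromℕ-cancel-≤ {a} {b} fa≤fb with ℕ.≤-<-connex a b
... | inj₁ a≤b = a≤b
... | inj₂ b<a = contradiction fa≤fb (<⇒≱ (fromℕ-mono-< b<a))

fromℕ-cancel-< : ∀ {a b} → fromℕ a < fromℕ b → a ℕ.< b
fromℕ-cancel-< {a} {b} fa<fb with ℕ.<-≤-connex a b
... | inj₁ a<b = a<b
... | inj₂ b≤a = contradiction (fromℕ-mono-≤ b≤a) (<⇒≱ fa<fb)

fromℕ*≡ℕ× : ∀ a y → fromℕ a * y ≡ a ℕ× y
fromℕ*≡ℕ× a y = trans (×-assoc-* a 1ℚ y) (cong (a ℕ×_) (ℚ.*-identityˡ y))

𝟙-∧ : ∀ a b → 𝟙 (a ∧ b) ≡ 𝟙 a * 𝟙 b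
𝟙-∧ true  b = sym (ℚ.*-identityˡ (𝟙 b))
𝟙-∧ false b = sym (ℚ.*-zeroˡ (𝟙 b))

𝟙-nonNeg : ∀ b → 0ℚ ≤ 𝟙 b
𝟙-nonNeg true  = 0≤1
𝟙-nonNeg false = ℚ.≤-refl

∑-mono-≤ : ∀ {n} {f g : Fin n → ℚ} → (∀ i → f i ≤ g i) → sum f ≤ sum g
∑-mono-≤ {zero}  f≤g = ℚ.≤-refl
∑-mono-≤ {suc n} f≤g = ℚ.+-mono-≤ (f≤g zero) (∑-mono-≤ (f≤g ∘ suc))

∑-mono-< : ∀ {n} {f g : Fin n → ℚ} j → (∀ i → f i ≤ g i) → f j < g j → sum f < sum g
∑-mono-< {suc n} {f} {g} j f≤g fj<gj rewrite sum-remove {i = j} f | sum-remove {i = j} g =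
  ℚ.+-mono-<-≤ fj<gj (∑-mono-≤ (f≤g ∘ punchIn j))

∑-nonNeg : ∀ {n} {f : Fin n → ℚ} → (∀ i → 0ℚ ≤ f i) → 0ℚ ≤ sum f
∑-nonNeg {n} {f} 0≤f = subst (_≤ sum f) (sum-replicate-zero n) (∑-mono-≤ 0≤f)

∑-zero : ∀ {n} {f : Fin n → ℚ} → (∀ i → f i ≡ 0ℚ) → sum f ≡ 0ℚ
∑-zero {n} f≡0 = trans (sum-cong-≗ f≡0) (sum-replicate-zero n)

term≤∑ : ∀ {n} {f : Fin n → ℚ} → (∀ i → 0ℚ ≤ f i) → ∀ j → f j ≤ sum f
term≤∑ {suc n} {f} 0≤f j rewrite sum-remove {i = j} f =
  subst (_≤ f j + sum (f ∘ punchIn j)) (ℚ.+-identityʳ (f j)) (ℚ.+-monoʳ-≤ (f j) (∑-nonNeg (0≤f ∘ punchIn j)))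

pair≤∑ : ∀ {n} {f : Fin n → ℚ} → (∀ i → 0ℚ ≤ f i) → ∀ {i j} → i ≢ j → f i + f j ≤ sum f
pair≤∑ {suc n} {f} 0≤f {i} {j} i≢j rewrite sum-remove {i = i} f =
  ℚ.+-monoʳ-≤ (f i) (subst (λ k → f k ≤ sum (f ∘ punchIn i)) (Fin.punchIn-punchOut i≢j)
                       (term≤∑ (0≤f ∘ punchIn i) (Fin.punchOut i≢j)))

∑-pick : ∀ {n} (j : Fin n) (f : Fin n → ℚ) → ∑[ i < n ] (𝟙 (does (i Fin.≟ j)) * f i) ≡ f j
∑-pick {suc n} j f = begin
  ∑[ i < suc n ] (𝟙 (does (i Fin.≟ j)) * f i)
    ≡⟨ sum-remove {i = j} (λ i → 𝟙 (does (i Fin.≟ j)) * f i) ⟩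
  𝟙 (does (j Fin.≟ j)) * f j + ∑[ l < n ] (𝟙 (does (punchIn j l Fin.≟ j)) * f (punchIn j l))
    ≡⟨ cong₂ (λ b s → 𝟙 b * f j + s) (dec-true (j Fin.≟ j) refl) (∑-zero off-diagonal) ⟩
  1ℚ * f j + 0ℚ
    ≡⟨ trans (ℚ.+-identityʳ (1ℚ * f j)) (ℚ.*-identityˡ (f j)) ⟩
  f j ∎
  where
  open ≡-Reasoning
  off-diagonal : ∀ l → 𝟙 (does (punchIn j l Fin.≟ j)) * f (punchIn j l) ≡ 0ℚ
  off-diagonal l rewrite dec-false (punchIn j l Fin.≟ j) (Fin.punchInᵢ≢i j l) = ℚ.*-zeroˡ (f (punchIn j l))

∑-splitAt : ∀ a {b} (f : Fin (a ℕ.+ b) → ℚ) → sum f ≡ ∑[ i < a ] f (i ↑ˡ b) + ∑[ i < b ] f (a ↑ʳ i)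
∑-splitAt zero    f = sym (ℚ.+-identityˡ _)
∑-splitAt (suc a) f = trans (cong (f zero +_) (∑-splitAt a (f ∘ suc))) (sym (ℚ.+-assoc (f zero) _ _))

∑-combine : ∀ a {b} (f : Fin (a ℕ.* b) → ℚ) → sum f ≡ ∑[ i < a ] ∑[ j < b ] f (combine i j)
∑-combine zero    f = refl
∑-combine (suc a) {b} f =
  trans (∑-splitAt b f) (cong (sum (λ j → f (j ↑ˡ (a ℕ.* b))) +_) (∑-combine a (f ∘ (b ↑ʳ_))))

fromℕ-countFin : ∀ {n} (p : Fin n → Bool) → fromℕ (countFin p) ≡ ∑[ i < n ] 𝟙 (p i)
fromℕ-countFin {zero}  p = refl
fromℕ-countFin {suc n} p = trans (×-homo-+ 1ℚ (if p zero then 1 else 0) (countFin (p ∘ suc)))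
  (cong₂ _+_ (first (p zero)) (fromℕ-countFin (p ∘ suc)))
  where
  first : ∀ b → fromℕ (if b then 1 else 0) ≡ 𝟙 b
  first true  = refl
  first false = refl

countFin-mono : ∀ {n} {p q : Fin n → Bool} → (∀ i → T (p i) → T (q i)) → countFin p ℕ.≤ countFin q
countFin-mono {zero}          p⇒q = ℕ.z≤n
countFin-mono {suc n} {p} {q} p⇒q with p zero | q zero | p⇒q zero
... | true  | true  | _    = ℕ.s≤s (countFin-mono (p⇒q ∘ suc))
... | true  | false | p⇒q₀ = contradiction (p⇒q₀ tt) λ ()
... | false | true  | _    = ℕ.m≤n⇒m≤1+n (countFin-mono (p⇒q ∘ suc))
... | false | false | _    = countFin-mono (p⇒q ∘ suc)

countFin-mono-< : ∀ {n} {p q : Fin n → Bool} → (∀ i → T (p i) → T (q i)) →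
                  ∀ j → ¬ T (p j) → T (q j) → countFin p ℕ.< countFin q
countFin-mono-< {suc n} {p} {q} p⇒q zero ¬p₀ q₀ with p zero | q zero
... | true  | _     = contradiction tt ¬p₀
... | false | true  = ℕ.s≤s (countFin-mono (p⇒q ∘ suc))
... | false | false = contradiction q₀ λ ()
countFin-mono-< {suc n} {p} {q} p⇒q (suc j) ¬pj qj with p zero | q zero | p⇒q zero
... | true  | true  | _    = ℕ.s≤s (countFin-mono-< (p⇒q ∘ suc) j ¬pj qj)
... | true  | false | p⇒q₀ = contradiction (p⇒q₀ tt) λ ()
... | false | true  | _    = ℕ.m≤n⇒m≤1+n (countFin-mono-< (p⇒q ∘ suc) j ¬pj qj)
... | false | false | _    = countFin-mono-< (p⇒q ∘ suc) j ¬pj qj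

countFin-complement : ∀ {n} (p : Fin n → Bool) → countFin p ℕ.+ countFin (not ∘ p) ≡ n
countFin-complement {zero}  p = refl
countFin-complement {suc n} p with p zero
... | true  = cong suc (countFin-complement (p ∘ suc))
... | false = trans (ℕ.+-suc (countFin (p ∘ suc)) _) (cong suc (countFin-complement (p ∘ suc)))

countFin-∈ : ∀ {n} (s : Subset n) → countFin (λ v → does (v ∈? s)) ≡ ∣ s ∣
countFin-∈ []            = refl
countFin-∈ (inside  ∷ s) = cong suc (countFin-∈ s)
countFin-∈ (outside ∷ s) = countFin-∈ s

maxFin-≥ : ∀ {m} (f : Fin m → ℕ) e → f e ℕ.≤ maxFin f
maxFin-≥ f zero    = ℕ.m≤m⊔n (f zero) _
maxFin-≥ f (suc e) = ℕ.≤-trans (maxFin-≥ (f ∘ suc) e) (ℕ.m≤n⊔m (f zero) _)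

-- Linear algebra

infix 7 _·_

_·_ : ∀ {q} → (Fin q → ℚ) → (Fin q → ℚ) → ℚ
a · z = ∑[ j < _ ] (a j * z j)

·-zeroˡ : ∀ {q} {a : Fin q → ℚ} → (∀ j → a j ≡ 0ℚ) → ∀ z → a · z ≡ 0ℚ
·-zeroˡ a≡0 z = ∑-zero λ j → trans (cong (_* z j) (a≡0 j)) (ℚ.*-zeroˡ (z j))

·-shift : ∀ {q} (a x z : Fin q → ℚ) t → a · (λ j → x j + t * z j) ≡ a · x + t * (a · z)
·-shift a x z t = begin
  ∑[ j < _ ] (a j * (x j + t * z j))
    ≡⟨ sum-cong-≗ (λ j → solve 4 (λ a x t z → a :* (x :+ t :* z) := a :* x :+ t :* (a :* z)) refl (a j) (x j) t (z j)) ⟩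
  ∑[ j < _ ] (a j * x j + t * (a j * z j))
    ≡⟨ ∑-distrib-+ (λ j → a j * x j) (λ j → t * (a j * z j)) ⟩
  a · x + ∑[ j < _ ] (t * (a j * z j))
    ≡⟨ cong (a · x +_) (sym (*-distribˡ-sum t (λ j → a j * z j))) ⟩
  a · x + t * (a · z) ∎
  where
  open ≡-Reasoning
  open +-*-Solver

module GaussStep {q} (a : Fin (suc q) → ℚ) (j : Fin (suc q)) (aj≢0 : a j ≢ 0ℚ) where
  open +-*-Solver

  ν : ℚ
  ν = (1/ a j) {{≢-nonZero aj≢0}}

  eliminate : (Fin (suc q) → ℚ) → Fin q → ℚ
  eliminate c l = c (punchIn j l) - c j * ν * a (punchIn j l)

  eliminate-pivot : ∀ w → eliminate a · w ≡ 0ℚ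
  eliminate-pivot = ·-zeroˡ λ l → begin
    a (punchIn j l) - a j * ν * a (punchIn j l) ≡⟨ cong (λ t → a (punchIn j l) - t * a (punchIn j l)) aj*ν≡1 ⟩
    a (punchIn j l) - 1ℚ * a (punchIn j l)      ≡⟨ solve 1 (λ x → x :- con 1ℚ :* x := con 0ℚ) refl (a (punchIn j l)) ⟩
    0ℚ                                          ∎
    where
    open ≡-Reasoning
    aj*ν≡1 : a j * ν ≡ 1ℚ
    aj*ν≡1 = ℚ.*-inverseʳ (a j) {{≢-nonZero aj≢0}}

  backSubstitute : (Fin q → ℚ) → Fin (suc q) → ℚ
  backSubstitute w = insertAt w j (- ν * (removeAt a j · w))

  ·-backSubstitute : ∀ c w → c · backSubstitute w ≡ eliminate c · w
  ·-backSubstitute c w = begin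
    c · z
      ≡⟨ sum-remove {i = j} (λ i → c i * z i) ⟩
    c j * z j + ∑[ l < q ] (c (punchIn j l) * z (punchIn j l))
      ≡⟨ cong₂ (λ u v → c j * u + v) (Vector.insertAt-lookup w j _)
                (sum-cong-≗ λ l → cong (c (punchIn j l) *_) (Vector.insertAt-punchIn w j _ l)) ⟩
    c j * (- ν * S) + T′
      ≡⟨ cong (_+ T′) (solve 3 (λ x y s → x :* (:- y :* s) := (:- (x :* y)) :* s) refl (c j) ν S) ⟩
    (- (c j * ν)) * S + T′
      ≡⟨ cong (_+ T′) (*-distribˡ-sum (- (c j * ν)) (λ l → a (punchIn j l) * w l)) ⟩
    ∑[ l < q ] ((- (c j * ν)) * (a (punchIn j l) * w l)) + T′
      ≡⟨ sym (∑-distrib-+ (λ l → (- (c j * ν)) * (a (punchIn j l) * w l)) (λ l → c (punchIn j l) * w l)) ⟩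
    ∑[ l < q ] ((- (c j * ν)) * (a (punchIn j l) * w l) + c (punchIn j l) * w l)
      ≡⟨ sum-cong-≗ (λ l → solve 4 (λ x y u v → (:- x) :* (y :* v) :+ u :* v := (u :- x :* y) :* v) refl
                                   (c j * ν) (a (punchIn j l)) (c (punchIn j l)) (w l)) ⟩
    eliminate c · w ∎
    where
    open ≡-Reasoning
    z  = backSubstitute w
    S  = removeAt a j · w
    T′ = ∑[ l < q ] (c (punchIn j l) * w l)

extendByZero : ∀ {q} → (Fin q → ℚ) → Fin (suc q) → ℚ
extendByZero w zero    = 0ℚ
extendByZero w (suc l) = w l

·-extendByZero : ∀ {q} (c : Fin (suc q) → ℚ) w → c · extendByZero w ≡ (c ∘ suc) · w
·-extendByZero c w = trans (cong (_+ (c ∘ suc) · w) (ℚ.*-zeroʳ (c zero))) (ℚ.+-identityˡ _)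

Nontrivial : ∀ {q} → (Fin q → ℚ) → Set
Nontrivial z = ∃ λ j → z j ≢ 0ℚ

nontrivialKernel : ∀ {q} (L : List (Fin q → ℚ)) → length L ℕ.< q →
                   ∃ λ z → All (λ a → a · z ≡ 0ℚ) L × Nontrivial z
nontrivialKernel {suc q} []      _             = (λ _ → 1ℚ) , [] , zero , ℚ.1≢0
nontrivialKernel {suc q} (a ∷ L) (ℕ.s≤s |L|<q) with any? (λ j → ¬? (a j ℚ.≟ 0ℚ))
... | no a≡0
  with nontrivialKernel (map (_∘ suc) L) (subst (ℕ._< q) (sym (List.length-map (_∘ suc) L)) |L|<q)
...   | w , L⊥w , (l , wl≢0) =
  extendByZero w ,
  ·-zeroˡ (λ j → decidable-stable (a j ℚ.≟ 0ℚ) (a≡0 ∘ (j ,_))) (extendByZero w)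
    ∷ All.map (λ {c} → trans (·-extendByZero c w)) (All.map⁻ L⊥w) ,
  suc l , wl≢0
nontrivialKernel {suc q} (a ∷ L) (ℕ.s≤s |L|<q) | yes (j , aj≢0)
  with nontrivialKernel (map (GaussStep.eliminate a j aj≢0) L)
                        (subst (ℕ._< q) (sym (List.length-map (GaussStep.eliminate a j aj≢0) L)) |L|<q)
... | w , L⊥w , (l , wl≢0) =
  backSubstitute w ,
  trans (·-backSubstitute a w) (eliminate-pivot w)
    ∷ All.map (λ {c} → trans (·-backSubstitute c w)) (All.map⁻ L⊥w) ,
  punchIn j l , subst (_≢ 0ℚ) (sym (Vector.insertAt-punchIn w j _ l)) wl≢0
  where open GaussStep a j aj≢0

flatten : ∀ {a b} {A : Set} → (Fin a → Fin b → A) → Fin (a ℕ.* b) → A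
flatten {b = b} f w = uncurry f (remQuot b w)

flatten-combine : ∀ {a b} {A : Set} (f : Fin a → Fin b → A) i j → flatten f (combine i j) ≡ f i j
flatten-combine f i j = cong (uncurry f) (Fin.remQuot-combine i j)

∑-flatten : ∀ {a b} (f : Fin a → Fin b → ℚ) → sum (flatten f) ≡ ∑[ i < a ] ∑[ j < b ] f i j
∑-flatten {a} f = trans (∑-combine a (flatten f)) (sum-cong-≗ λ i → sum-cong-≗ λ j → flatten-combine f i j)

·-flatten : ∀ {a b} (f : Fin a → Fin b → ℚ) z → flatten f · z ≡ ∑[ i < a ] ∑[ j < b ] (f i j * z (combine i j))
·-flatten {a} f z = trans (∑-combine a (λ w → flatten f w * z w))
  (sum-cong-≗ λ i → sum-cong-≗ λ j → cong (_* z (combine i j)) (flatten-combine f i j))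

select : ∀ {p} {A : Set} → (Fin p → Bool) → (Fin p → A) → List A
select {zero}  b f = []
select {suc p} b f = (if b zero then f zero ∷_ else id) (select (b ∘ suc) (f ∘ suc))

length-select : ∀ {p} {A : Set} (b : Fin p → Bool) (f : Fin p → A) → length (select b f) ≡ countFin b
length-select {zero}  b f = refl
length-select {suc p} b f with b zero
... | true  = cong suc (length-select (b ∘ suc) (f ∘ suc))
... | false = length-select (b ∘ suc) (f ∘ suc)

All-select : ∀ {p} {A : Set} {P : A → Set} (b : Fin p → Bool) (f : Fin p → A) →
             All P (select b f) → ∀ i → T (b i) → P (f i)
All-select {suc p} b f Pbf zero bi with b zero
All-select {suc p} b f (Pf₀ ∷ _) zero bi | true  = Pf₀
All-select {suc p} b f Pbf       zero () | false
All-select {suc p} b f Pbf (suc i) bi with b zero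
All-select {suc p} b f (_ ∷ Pbf) (suc i) bi | true  = All-select (b ∘ suc) (f ∘ suc) Pbf i bi
All-select {suc p} b f Pbf       (suc i) bi | false = All-select (b ∘ suc) (f ∘ suc) Pbf i bi

-- Moving to the boundary of the unit cube

Frac : ℚ → Set
Frac y = 0ℚ < y × y < 1ℚ

InUnit : ℚ → Set
InUnit y = 0ℚ ≤ y × y ≤ 1ℚ

-- Opaque, so that `with` can abstract over `a <? b` and `frac? y`: unfolded, they reduce
-- inside goals to integer comparisons that `with` no longer recognises.
opaque
  _<?_ : (a b : ℚ) → Dec (a < b)
  _<?_ = ℚ._<?_

  frac? : (y : ℚ) → Dec (Frac y)
  frac? y = 0ℚ <? y ×-dec y <? 1ℚ

pos? : (y : ℚ) → Dec (0ℚ < y)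
pos? y = 0ℚ <? y

exitTime : ℚ → ℚ → ℚ
exitTime y c with ℚ.<-cmp c 0ℚ
... | tri< c<0 _ _ = y * (1/ (- c)) {{>-nonZero (ℚ.neg-antimono-< c<0)}}
... | tri≈ _ _ _   = 0ℚ
... | tri> _ _ c>0 = (1ℚ - y) * (1/ c) {{>-nonZero c>0}}

along-mono : ∀ y {c s t} → 0ℚ ≤ c → s ≤ t → y + s * c ≤ y + t * c
along-mono y {c} 0≤c s≤t = ℚ.+-monoʳ-≤ y (ℚ.*-monoʳ-≤-nonNeg c {{nonNegative 0≤c}} s≤t)

along-anti : ∀ y {c s t} → c ≤ 0ℚ → s ≤ t → y + t * c ≤ y + s * c
along-anti y {c} c≤0 s≤t = ℚ.+-monoʳ-≤ y (ℚ.*-monoʳ-≤-nonPos c {{nonPositive c≤0}} s≤t)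

along-start : ∀ y c → y + 0ℚ * c ≡ y
along-start y c = trans (cong (y +_) (ℚ.*-zeroˡ c)) (ℚ.+-identityʳ y)

exit-at-0 : ∀ y {c} (c<0 : c < 0ℚ) → y + y * (1/ (- c)) {{>-nonZero (ℚ.neg-antimono-< c<0)}} * c ≡ 0ℚ
exit-at-0 y {c} c<0 = begin
  y + y * w * c       ≡⟨ solve 3 (λ y w c → y :+ y :* w :* c := y :- y :* (w :* (:- c))) refl y w c ⟩
  y - y * (w * (- c)) ≡⟨ cong (λ u → y - y * u) (ℚ.*-inverseˡ (- c) {{>-nonZero (ℚ.neg-antimono-< c<0)}}) ⟩
  y - y * 1ℚ          ≡⟨ solve 1 (λ y → y :- y :* con 1ℚ := con 0ℚ) refl y ⟩
  0ℚ                  ∎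
  where
  open ≡-Reasoning
  open +-*-Solver
  w = (1/ (- c)) {{>-nonZero (ℚ.neg-antimono-< c<0)}}

exit-at-1 : ∀ y {c} (c>0 : 0ℚ < c) → y + (1ℚ - y) * (1/ c) {{>-nonZero c>0}} * c ≡ 1ℚ
exit-at-1 y {c} c>0 = begin
  y + (1ℚ - y) * w * c   ≡⟨ solve 3 (λ y w c → y :+ (con 1ℚ :- y) :* w :* c := y :+ (con 1ℚ :- y) :* (w :* c)) refl y w c ⟩
  y + (1ℚ - y) * (w * c) ≡⟨ cong (λ u → y + (1ℚ - y) * u) (ℚ.*-inverseˡ c {{>-nonZero c>0}}) ⟩
  y + (1ℚ - y) * 1ℚ      ≡⟨ solve 1 (λ y → y :+ (con 1ℚ :- y) :* con 1ℚ := con 1ℚ) refl y ⟩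
  1ℚ                     ∎
  where
  open ≡-Reasoning
  open +-*-Solver
  w = (1/ c) {{>-nonZero c>0}}

exitTime-exits : ∀ {y c} → Frac y → c ≢ 0ℚ → 0ℚ < exitTime y c × ¬ Frac (y + exitTime y c * c)
exitTime-exits {y} {c} (0<y , y<1) c≢0 with ℚ.<-cmp c 0ℚ
... | tri< c<0 _ _ = 0<* 0<y (0<1/ (ℚ.neg-antimono-< c<0)) , λ (0<y′ , _) → ℚ.<-irrefl (sym (exit-at-0 y c<0)) 0<y′
... | tri≈ _ c≡0 _ = contradiction c≡0 c≢0
... | tri> _ _ c>0 = 0<* (0<1-y y<1) (0<1/ c>0) , λ (_ , y′<1) → ℚ.<-irrefl (exit-at-1 y c>0) y′<1

exitTime-inUnit : ∀ {y c s} → InUnit y → 0ℚ ≤ s → s ≤ exitTime y c → InUnit (y + s * c)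
exitTime-inUnit {y} {c} {s} (0≤y , y≤1) 0≤s s≤t with ℚ.<-cmp c 0ℚ
... | tri< c<0 _ _ =
  subst (_≤ y + s * c) (exit-at-0 y c<0) (along-anti y (ℚ.<⇒≤ c<0) s≤t) ,
  ℚ.≤-trans (subst (y + s * c ≤_) (along-start y c) (along-anti y (ℚ.<⇒≤ c<0) 0≤s)) y≤1
... | tri≈ _ refl _ = subst InUnit (sym (+*0 y s)) (0≤y , y≤1)
... | tri> _ _ c>0 =
  ℚ.≤-trans 0≤y (subst (_≤ y + s * c) (along-start y c) (along-mono y (ℚ.<⇒≤ c>0) 0≤s)) ,
  subst (y + s * c ≤_) (exit-at-1 y c>0) (along-mono y (ℚ.<⇒≤ c>0) s≤t)

shift-inUnit : ∀ {N} (x z : Fin N → ℚ) {t} → (∀ j → InUnit (x j)) → 0ℚ ≤ t →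
               (∀ j → z j ≢ 0ℚ → t ≤ exitTime (x j) (z j)) → ∀ j → InUnit (x j + t * z j)
shift-inUnit x z {t} x∈[0,1] 0≤t t≤exit j with z j ℚ.≟ 0ℚ
... | yes zj≡0 = subst InUnit (sym (trans (cong (λ c → x j + t * c) zj≡0) (+*0 (x j) t))) (x∈[0,1] j)
... | no  zj≢0 = exitTime-inUnit (x∈[0,1] j) 0≤t (t≤exit j zj≢0)

moveToBoundary : ∀ {N} (x z : Fin N → ℚ) → (∀ j → InUnit (x j)) → (∀ j → z j ≢ 0ℚ → Frac (x j)) → Nontrivial z →
                 ∃ λ t → (∀ j → InUnit (x j + t * z j)) × ∃ λ j → z j ≢ 0ℚ × ¬ Frac (x j + t * z j)
moveToBoundary {N} x z x∈[0,1] z≢0⇒frac (j₀ , zj₀≢0) =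
  exit j* , shift-inUnit x z x∈[0,1] (ℚ.<⇒≤ (proj₁ exits*)) exit*≤exit , j* , zj*≢0 , proj₂ exits*
  where
  open Data.List.Extrema (DecTotalOrder.totalOrder ℚ.≤-decTotalOrder) using (argmin; argmin-all; f[argmin]≤f[xs])

  exit : Fin N → ℚ
  exit j = exitTime (x j) (z j)

  moving? : ∀ j → Dec (z j ≢ 0ℚ)
  moving? j = ¬? (z j ℚ.≟ 0ℚ)

  j* : Fin N
  j* = argmin exit j₀ (filter moving? (allFin N))

  zj*≢0 : z j* ≢ 0ℚ
  zj*≢0 = argmin-all exit zj₀≢0 (All.all-filter moving? (allFin N))

  exit*≤exit : ∀ j → z j ≢ 0ℚ → exit j* ≤ exit j
  exit*≤exit j zj≢0 = All.lookup (f[argmin]≤f[xs] j₀ (filter moving? (allFin N))) (∈-filter⁺ moving? (∈-allFin j) zj≢0)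

  exits* : 0ℚ < exit j* × ¬ Frac (x j* + exit j* * z j*)
  exits* = exitTime-exits (z≢0⇒frac j* zj*≢0) zj*≢0

-- Rounding a fractional edge-colouring

gap : ℚ → ℚ
gap y = if does (frac? y) then 1ℚ - y else 0ℚ

fracPart : ℚ → ℚ
fracPart y = if does (frac? y) then y else 0ℚ

gap-pos : ∀ {y} → Frac y → 0ℚ < gap y
gap-pos {y} frac with frac? y
... | yes (_ , y<1) = 0<1-y y<1
... | no  ¬frac     = contradiction frac ¬frac

gap-nonNeg : ∀ {y} → y ≤ 1ℚ → 0ℚ ≤ gap y
gap-nonNeg {y} y≤1 with frac? y
... | yes (_ , y<1) = ℚ.<⇒≤ (0<1-y y<1)
... | no  _         = ℚ.≤-refl

gap+fracPart : ∀ y → gap y + fracPart y ≡ 𝟙 (does (frac? y))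
gap+fracPart y with frac? y
... | yes _ = solve 1 (λ y → (con 1ℚ :- y) :+ y := con 1ℚ) refl y
  where open +-*-Solver
... | no  _ = refl

𝟙-pos≡y+gap : ∀ {y} → InUnit y → 𝟙 (does (pos? y)) ≡ y + gap y
𝟙-pos≡y+gap {y} (0≤y , y≤1) with pos? y | frac? y
... | yes _   | yes _         = solve 1 (λ y → con 1ℚ := y :+ (con 1ℚ :- y)) refl y
  where open +-*-Solver
... | yes 0<y | no ¬frac      = sym (trans (ℚ.+-identityʳ y) (ℚ.≤-antisym y≤1 (ℚ.≮⇒≥ (¬frac ∘ (0<y ,_)))))
... | no  y≯0 | no _          = sym (trans (ℚ.+-identityʳ y) (ℚ.≤-antisym (ℚ.≮⇒≥ y≯0) 0≤y))
... | no  y≯0 | yes (0<y , _) = contradiction 0<y y≯0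

module Rounding {n m : ℕ} (G : Hypergraph n m) (K : ℕ) where

  incident : Fin n → Fin m → Bool
  incident v e = does (v ∈? edge G e)

  R : ℚ
  R = fromℕ (rank G)

  ∑-incident≤R : ∀ e → ∑[ v < n ] 𝟙 (incident v e) ≤ R
  ∑-incident≤R e = subst (_≤ R) (trans (cong fromℕ (sym (countFin-∈ (edge G e)))) (fromℕ-countFin (λ v → incident v e)))
                     (fromℕ-mono-≤ (maxFin-≥ (λ e → ∣ edge G e ∣) e))

  -- x (combine e i) is the weight of colour i on edge e.
  Weights : Set
  Weights = Fin (m ℕ.* K) → ℚ

  rowSum : Weights → Fin m → ℚ
  rowSum x e = ∑[ i < K ] x (combine e i)

  load : Weights → Fin n → Fin K → ℚ
  load x v i = ∑[ e < m ] (𝟙 (incident v e) * x (combine e i))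

  deficit : Weights → Fin n → Fin K → ℚ
  deficit x v i = ∑[ e < m ] (𝟙 (incident v e) * gap (x (combine e i)))

  support : Weights → Fin n → Fin K → ℕ
  support x v i = countFin (λ e → incident v e ∧ does (pos? (x (combine e i))))

  record FractionalColouring (x : Weights) : Set where
    field
      inUnit   : ∀ j → InUnit (x j)
      rowSum≡1 : ∀ e → rowSum x e ≡ 1ℚ

  open FractionalColouring

  fractionalEntries : Weights → ℕ
  fractionalEntries x = countFin (λ j → does (frac? (x j)))

  fractionalRow : Weights → Fin m → Bool
  fractionalRow x e = does (any? (λ i → frac? (x (combine e i))))

  frozen : Weights → Fin (n ℕ.* K) → Bool
  frozen x w = does (R <? flatten (deficit x) w)

  support≡load+deficit : ∀ {x} → (∀ j → InUnit (x j)) → ∀ v i → fromℕ (support x v i) ≡ load x v i + deficit x v i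
  support≡load+deficit {x} x∈[0,1] v i = begin
    fromℕ (support x v i)
      ≡⟨ fromℕ-countFin (λ e → incident v e ∧ does (pos? (x (combine e i)))) ⟩
    ∑[ e < m ] 𝟙 (incident v e ∧ does (pos? (x (combine e i))))
      ≡⟨ sum-cong-≗ (λ e → trans (𝟙-∧ (incident v e) _) (cong (𝟙 (incident v e) *_) (𝟙-pos≡y+gap (x∈[0,1] (combine e i))))) ⟩
    ∑[ e < m ] (𝟙 (incident v e) * (x (combine e i) + gap (x (combine e i))))
      ≡⟨ sum-cong-≗ (λ e → ℚ.*-distribˡ-+ (𝟙 (incident v e)) _ _) ⟩
    ∑[ e < m ] (𝟙 (incident v e) * x (combine e i) + 𝟙 (incident v e) * gap (x (combine e i)))
      ≡⟨ ∑-distrib-+ (λ e → 𝟙 (incident v e) * x (combine e i)) (λ e → 𝟙 (incident v e) * gap (x (combine e i))) ⟩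
    load x v i + deficit x v i ∎
    where open ≡-Reasoning

  deficit-nonNeg : ∀ {x} → (∀ j → x j ≤ 1ℚ) → ∀ v i → 0ℚ ≤ deficit x v i
  deficit-nonNeg {x} x≤1 v i = ∑-nonNeg λ e → 0≤* (𝟙-nonNeg (incident v e)) (gap-nonNeg (x≤1 (combine e i)))

  -- A 1 next to a positive entry would push the row sum above 1.
  nonFractional≡0 : ∀ {x} → FractionalColouring x → ∀ {e i₀ i} → Frac (x (combine e i₀)) → ¬ Frac (x (combine e i)) →
                    x (combine e i) ≡ 0ℚ
  nonFractional≡0 {x} fx {e} {i₀} {i} frac₀ ¬frac with pos? (x (combine e i))
  ... | no  ¬pos = ℚ.≤-antisym (ℚ.≮⇒≥ ¬pos) (proj₁ (inUnit fx (combine e i)))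
  ... | yes pos  = contradiction (ℚ.≤-trans (pair≤∑ (proj₁ ∘ inUnit fx ∘ combine e) i≢i₀) (ℚ.≤-reflexive (rowSum≡1 fx e)))
                                 (<⇒≱ (ℚ.+-mono-≤-< (ℚ.≮⇒≥ (¬frac ∘ (pos ,_))) (proj₁ frac₀)))
    where
    i≢i₀ : i ≢ i₀
    i≢i₀ refl = ¬frac frac₀

  ∑-fracPart-row : ∀ {x} → FractionalColouring x → ∀ e → ∑[ i < K ] fracPart (x (combine e i)) ≡ 𝟙 (fractionalRow x e)
  ∑-fracPart-row {x} fx e with any? (λ i → frac? (x (combine e i)))
  ... | yes (i₀ , frac₀) = trans (sum-cong-≗ whole) (rowSum≡1 fx e)
    where
    whole : ∀ i → fracPart (x (combine e i)) ≡ x (combine e i)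
    whole i with frac? (x (combine e i))
    ... | yes _    = refl
    ... | no ¬frac = sym (nonFractional≡0 fx frac₀ ¬frac)
  ... | no none = ∑-zero vanish
    where
    vanish : ∀ i → fracPart (x (combine e i)) ≡ 0ℚ
    vanish i with frac? (x (combine e i))
    ... | yes frac = contradiction (i , frac) none
    ... | no  _    = refl

  ∑gap+fractionalRows : ∀ {x} → FractionalColouring x →
    ∑[ j < m ℕ.* K ] gap (x j) + fromℕ (countFin (fractionalRow x)) ≡ fromℕ (fractionalEntries x)
  ∑gap+fractionalRows {x} fx = begin
    ∑gap + fromℕ (countFin (fractionalRow x))
      ≡⟨ cong (∑gap +_) (fromℕ-countFin (fractionalRow x)) ⟩
    ∑gap + ∑[ e < m ] 𝟙 (fractionalRow x e)
      ≡⟨ cong (∑gap +_) (sum-cong-≗ (sym ∘ ∑-fracPart-row fx)) ⟩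
    ∑gap + ∑[ e < m ] ∑[ i < K ] fracPart (x (combine e i))
      ≡⟨ cong (∑gap +_) (sym (∑-combine m (fracPart ∘ x))) ⟩
    ∑gap + ∑[ j < m ℕ.* K ] fracPart (x j)
      ≡⟨ sym (∑-distrib-+ (gap ∘ x) (fracPart ∘ x)) ⟩
    ∑[ j < m ℕ.* K ] (gap (x j) + fracPart (x j))
      ≡⟨ sum-cong-≗ (gap+fracPart ∘ x) ⟩
    ∑[ j < m ℕ.* K ] 𝟙 (does (frac? (x j)))
      ≡⟨ sym (fromℕ-countFin (λ j → does (frac? (x j)))) ⟩
    fromℕ (fractionalEntries x) ∎
    where
    open ≡-Reasoning
    ∑gap = ∑[ j < m ℕ.* K ] gap (x j)

  ∑-deficit≤ : ∀ {x} → (∀ j → x j ≤ 1ℚ) → ∑[ v < n ] ∑[ i < K ] deficit x v i ≤ R * ∑[ j < m ℕ.* K ] gap (x j)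
  ∑-deficit≤ {x} x≤1 = begin
    ∑[ v < n ] ∑[ i < K ] ∑[ e < m ] (𝟙 (incident v e) * g e i)
      ≡⟨ sum-cong-≗ (λ v → ∑-comm (λ i e → 𝟙 (incident v e) * g e i)) ⟩
    ∑[ v < n ] ∑[ e < m ] ∑[ i < K ] (𝟙 (incident v e) * g e i)
      ≡⟨ ∑-comm (λ v e → ∑[ i < K ] (𝟙 (incident v e) * g e i)) ⟩
    ∑[ e < m ] ∑[ v < n ] ∑[ i < K ] (𝟙 (incident v e) * g e i)
      ≡⟨ sum-cong-≗ (λ e → sum-cong-≗ λ v → sym (*-distribˡ-sum (𝟙 (incident v e)) (g e))) ⟩
    ∑[ e < m ] ∑[ v < n ] (𝟙 (incident v e) * ∑[ i < K ] g e i)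
      ≡⟨ sum-cong-≗ (λ e → sym (*-distribʳ-sum (∑[ i < K ] g e i) (λ v → 𝟙 (incident v e)))) ⟩
    ∑[ e < m ] (∑[ v < n ] 𝟙 (incident v e) * ∑[ i < K ] g e i)
      ≤⟨ ∑-mono-≤ (λ e → ℚ.*-monoʳ-≤-nonNeg (∑[ i < K ] g e i) {{nonNegative (∑-nonNeg (λ i → gap-nonNeg (x≤1 (combine e i))))}}
                                           (∑-incident≤R e)) ⟩
    ∑[ e < m ] (R * ∑[ i < K ] g e i)
      ≡⟨ sym (*-distribˡ-sum R (λ e → ∑[ i < K ] g e i)) ⟩
    R * ∑[ e < m ] ∑[ i < K ] g e i
      ≡⟨ cong (R *_) (sym (∑-combine m (gap ∘ x))) ⟩
    R * ∑[ j < m ℕ.* K ] gap (x j) ∎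
    where
    open ℚ.≤-Reasoning
    g : Fin m → Fin K → ℚ
    g e i = gap (x (combine e i))

  R*frozen≤deficit : ∀ {x} → (∀ j → x j ≤ 1ℚ) → ∀ w → R * 𝟙 (frozen x w) ≤ flatten (deficit x) w
  R*frozen≤deficit {x} x≤1 w with R <? flatten (deficit x) w
  ... | yes R<d = ℚ.≤-trans (ℚ.≤-reflexive (ℚ.*-identityʳ R)) (ℚ.<⇒≤ R<d)
  ... | no  _   = ℚ.≤-trans (ℚ.≤-reflexive (ℚ.*-zeroʳ R)) (uncurry (deficit-nonNeg x≤1) (remQuot K w))

  frozenCount<∑gap : ∀ {x} → FractionalColouring x → ∀ {j₀} → Frac (x j₀) →
                     fromℕ (countFin (frozen x)) < ∑[ j < m ℕ.* K ] gap (x j)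
  frozenCount<∑gap {x} fx {j₀} frac₀ with any? (λ w → R <? flatten (deficit x) w)
  ... | yes (w₀ , R<d₀) = ℚ.*-cancelˡ-<-nonNeg R {{nonNegative (fromℕ-nonNeg (rank G))}} (begin-strict
    R * fromℕ (countFin (frozen x))
      ≡⟨ cong (R *_) (fromℕ-countFin (frozen x)) ⟩
    R * ∑[ w < n ℕ.* K ] 𝟙 (frozen x w)
      ≡⟨ *-distribˡ-sum R (𝟙 ∘ frozen x) ⟩
    ∑[ w < n ℕ.* K ] (R * 𝟙 (frozen x w))
      <⟨ ∑-mono-< w₀ (R*frozen≤deficit x≤1) strict₀ ⟩
    ∑[ w < n ℕ.* K ] flatten (deficit x) w
      ≡⟨ ∑-flatten (deficit x) ⟩
    ∑[ v < n ] ∑[ i < K ] deficit x v i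
      ≤⟨ ∑-deficit≤ x≤1 ⟩
    R * ∑[ j < m ℕ.* K ] gap (x j) ∎)
    where
    open ℚ.≤-Reasoning
    x≤1 = proj₂ ∘ inUnit fx
    strict₀ : R * 𝟙 (frozen x w₀) < flatten (deficit x) w₀
    strict₀ rewrite dec-true (R <? flatten (deficit x) w₀) R<d₀ =
      subst (_< flatten (deficit x) w₀) (sym (ℚ.*-identityʳ R)) R<d₀
  ... | no none = begin-strict
    fromℕ (countFin (frozen x))     ≡⟨ fromℕ-countFin (frozen x) ⟩
    ∑[ w < n ℕ.* K ] 𝟙 (frozen x w) ≡⟨ ∑-zero (λ w → cong 𝟙 (dec-false (R <? flatten (deficit x) w) (none ∘ (w ,_)))) ⟩
    0ℚ                              <⟨ gap-pos frac₀ ⟩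
    gap (x j₀)                      ≤⟨ term≤∑ (λ j → gap-nonNeg (proj₂ (inUnit fx j))) j₀ ⟩
    ∑[ j < m ℕ.* K ] gap (x j)      ∎
    where open ℚ.≤-Reasoning

  fractionalRows+frozen<fractionalEntries : ∀ {x} → FractionalColouring x → ∀ {j₀} → Frac (x j₀) →
    countFin (fractionalRow x) ℕ.+ countFin (frozen x) ℕ.< fractionalEntries x
  fractionalRows+frozen<fractionalEntries {x} fx frac₀ = fromℕ-cancel-< (begin-strict
    fromℕ (#rows ℕ.+ #frozen)                ≡⟨ ×-homo-+ 1ℚ #rows #frozen ⟩
    fromℕ #rows + fromℕ #frozen              ≡⟨ ℚ.+-comm (fromℕ #rows) (fromℕ #frozen) ⟩
    fromℕ #frozen + fromℕ #rows              <⟨ ℚ.+-monoˡ-< (fromℕ #rows) (frozenCount<∑gap fx frac₀) ⟩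
    ∑[ j < m ℕ.* K ] gap (x j) + fromℕ #rows ≡⟨ ∑gap+fractionalRows fx ⟩
    fromℕ (fractionalEntries x)              ∎)
    where
    open ℚ.≤-Reasoning
    #rows   = countFin (fractionalRow x)
    #frozen = countFin (frozen x)

  unitForm : Fin (m ℕ.* K) → Weights
  unitForm j j′ = 𝟙 (does (j′ Fin.≟ j))

  rowForm : Fin m → Weights
  rowForm e = flatten λ e′ i → 𝟙 (does (e′ Fin.≟ e))

  loadForm : Fin (n ℕ.* K) → Weights
  loadForm = flatten λ v i → flatten λ e i′ → 𝟙 (incident v e) * 𝟙 (does (i′ Fin.≟ i))

  ·-unitForm : ∀ j z → unitForm j · z ≡ z j
  ·-unitForm = ∑-pick

  ·-rowForm : ∀ e z → rowForm e · z ≡ rowSum z e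
  ·-rowForm e z = begin
    rowForm e · z
      ≡⟨ ·-flatten (λ e′ i → 𝟙 (does (e′ Fin.≟ e))) z ⟩
    ∑[ e′ < m ] ∑[ i < K ] (𝟙 (does (e′ Fin.≟ e)) * z (combine e′ i))
      ≡⟨ sum-cong-≗ (λ e′ → sym (*-distribˡ-sum (𝟙 (does (e′ Fin.≟ e))) (z ∘ combine e′))) ⟩
    ∑[ e′ < m ] (𝟙 (does (e′ Fin.≟ e)) * rowSum z e′)
      ≡⟨ ∑-pick e (rowSum z) ⟩
    rowSum z e ∎
    where open ≡-Reasoning

  ·-loadForm : ∀ v i z → loadForm (combine v i) · z ≡ load z v i
  ·-loadForm v i z = begin
    loadForm (combine v i) · z
      ≡⟨ cong (_· z) (flatten-combine (λ v i → flatten (a v i)) v i) ⟩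
    flatten (a v i) · z
      ≡⟨ ·-flatten (a v i) z ⟩
    ∑[ e < m ] ∑[ i′ < K ] (𝟙 (incident v e) * 𝟙 (does (i′ Fin.≟ i)) * z (combine e i′))
      ≡⟨ sum-cong-≗ (λ e → trans (sum-cong-≗ λ i′ → ℚ.*-assoc (𝟙 (incident v e)) (𝟙 (does (i′ Fin.≟ i))) (z (combine e i′)))
                                 (sym (*-distribˡ-sum (𝟙 (incident v e)) λ i′ → 𝟙 (does (i′ Fin.≟ i)) * z (combine e i′)))) ⟩
    ∑[ e < m ] (𝟙 (incident v e) * ∑[ i′ < K ] (𝟙 (does (i′ Fin.≟ i)) * z (combine e i′)))
      ≡⟨ sum-cong-≗ (λ e → cong (𝟙 (incident v e) *_) (∑-pick i (z ∘ combine e))) ⟩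
    load z v i ∎
    where
    open ≡-Reasoning
    a : Fin n → Fin K → Fin m → Fin K → ℚ
    a v i e i′ = 𝟙 (incident v e) * 𝟙 (does (i′ Fin.≟ i))

  constraints : Weights → List Weights
  constraints x = select (not ∘ does ∘ frac? ∘ x) unitForm
               ++ select (fractionalRow x) rowForm
               ++ select (frozen x) loadForm

  fewerConstraintsThanEntries : ∀ {x} → FractionalColouring x → ∀ {j₀} → Frac (x j₀) →
                                length (constraints x) ℕ.< m ℕ.* K
  fewerConstraintsThanEntries {x} fx frac₀ = begin-strict
    length (constraints x)
      ≡⟨ List.length-++ (select (not ∘ does ∘ frac? ∘ x) unitForm) ⟩
    length (select (not ∘ does ∘ frac? ∘ x) unitForm) ℕ.+ length (select (fractionalRow x) rowForm ++ select (frozen x) loadForm)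
      ≡⟨ cong₂ ℕ._+_ (length-select (not ∘ does ∘ frac? ∘ x) unitForm)
                     (trans (List.length-++ (select (fractionalRow x) rowForm))
                            (cong₂ ℕ._+_ (length-select (fractionalRow x) rowForm) (length-select (frozen x) loadForm))) ⟩
    #integral ℕ.+ (countFin (fractionalRow x) ℕ.+ countFin (frozen x))
      <⟨ ℕ.+-monoʳ-< #integral (fractionalRows+frozen<fractionalEntries fx frac₀) ⟩
    #integral ℕ.+ fractionalEntries x
      ≡⟨ trans (ℕ.+-comm #integral (fractionalEntries x)) (countFin-complement (does ∘ frac? ∘ x)) ⟩
    m ℕ.* K ∎
    where
    open ℕ.≤-Reasoning
    #integral = countFin (not ∘ does ∘ frac? ∘ x)

  positiveEntry : ∀ {x} → FractionalColouring x → ∀ e → ∃ λ i → 0ℚ < x (combine e i)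
  positiveEntry {x} fx e with any? (λ i → pos? (x (combine e i)))
  ... | yes found = found
  ... | no  none  = contradiction (trans (sym (rowSum≡1 fx e)) (∑-zero λ i →
                      ℚ.≤-antisym (ℚ.≮⇒≥ (none ∘ (i ,_))) (proj₁ (inUnit fx (combine e i))))) ℚ.1≢0

  module StartingFrom (x₀ : Weights) where

    Controlled : Weights → Set
    Controlled x = ∀ v i → load x v i ≤ load x₀ v i ⊎ fromℕ (support x v i) ≤ load x₀ v i + R

    module KernelStep {x} (fx : FractionalColouring x) (ctrl : Controlled x)
                      (z : Weights) (z⊥ : All (λ a → a · z ≡ 0ℚ) (constraints x)) where

      z⊥units : All (λ a → a · z ≡ 0ℚ) (select (not ∘ does ∘ frac? ∘ x) unitForm)
      z⊥units = All.++⁻ˡ (select (not ∘ does ∘ frac? ∘ x) unitForm) z⊥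

      z⊥rows : All (λ a → a · z ≡ 0ℚ) (select (fractionalRow x) rowForm)
      z⊥rows = All.++⁻ˡ (select (fractionalRow x) rowForm) (All.++⁻ʳ (select (not ∘ does ∘ frac? ∘ x) unitForm) z⊥)

      z⊥loads : All (λ a → a · z ≡ 0ℚ) (select (frozen x) loadForm)
      z⊥loads = All.++⁻ʳ (select (fractionalRow x) rowForm) (All.++⁻ʳ (select (not ∘ does ∘ frac? ∘ x) unitForm) z⊥)

      z≡0-off-fractional : ∀ j → ¬ Frac (x j) → z j ≡ 0ℚ
      z≡0-off-fractional j ¬frac = trans (sym (·-unitForm j z))
        (All-select (not ∘ does ∘ frac? ∘ x) unitForm z⊥units j (subst (T ∘ not) (sym (dec-false (frac? (x j)) ¬frac)) tt))

      z≢0⇒fractional : ∀ j → z j ≢ 0ℚ → Frac (x j)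
      z≢0⇒fractional j zj≢0 = decidable-stable (frac? (x j)) (zj≢0 ∘ z≡0-off-fractional j)

      rowSum-z≡0 : ∀ e → rowSum z e ≡ 0ℚ
      rowSum-z≡0 e with any? (λ i → frac? (x (combine e i))) in eq
      ... | yes _   = trans (sym (·-rowForm e z)) (All-select (fractionalRow x) rowForm z⊥rows e (subst (T ∘ does) (sym eq) tt))
      ... | no none = ∑-zero λ i → z≡0-off-fractional (combine e i) (none ∘ (i ,_))

      load-z≡0 : ∀ v i → R < deficit x v i → load z v i ≡ 0ℚ
      load-z≡0 v i R<d = trans (sym (·-loadForm v i z)) (All-select (frozen x) loadForm z⊥loads (combine v i)
        (subst (λ d → T (does (R <? d))) (sym (flatten-combine (deficit x) v i)) (⇒does (R <? deficit x v i) R<d)))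

      module Shift (t : ℚ) where

        x′ : Weights
        x′ j = x j + t * z j

        unchanged-or-fractional : ∀ j → x′ j ≡ x j ⊎ Frac (x j)
        unchanged-or-fractional j with z j ℚ.≟ 0ℚ
        ... | yes zj≡0 = inj₁ (trans (cong (λ c → x j + t * c) zj≡0) (+*0 (x j) t))
        ... | no  zj≢0 = inj₂ (z≢0⇒fractional j zj≢0)

        fractional-shrinks : ∀ j → Frac (x′ j) → Frac (x j)
        fractional-shrinks j frac′ with unchanged-or-fractional j
        ... | inj₁ same = subst Frac same frac′
        ... | inj₂ frac = frac

        positive-shrinks : ∀ j → 0ℚ < x′ j → 0ℚ < x j
        positive-shrinks j pos′ with unchanged-or-fractional j
        ... | inj₁ same = subst (0ℚ <_) same pos′
        ... | inj₂ frac = proj₁ frac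

        preserved : ∀ a {α} → a · x ≡ α → a · z ≡ 0ℚ → a · x′ ≡ α
        preserved a {α} ax≡α az≡0 =
          trans (·-shift a x z t) (trans (cong₂ (λ u w → u + t * w) ax≡α az≡0) (+*0 α t))

        fractional′ : (∀ j → InUnit (x′ j)) → FractionalColouring x′
        fractional′ x′∈[0,1] = record
          { inUnit   = x′∈[0,1]
          ; rowSum≡1 = λ e → trans (sym (·-rowForm e x′))
              (preserved (rowForm e) (trans (·-rowForm e x) (rowSum≡1 fx e)) (trans (·-rowForm e z) (rowSum-z≡0 e)))
          }

        fewerFractional : ∀ j → z j ≢ 0ℚ → ¬ Frac (x′ j) → fractionalEntries x′ ℕ.< fractionalEntries x
        fewerFractional j zj≢0 ¬frac′ =
          countFin-mono-< (λ k → ⇒does (frac? (x k)) ∘ fractional-shrinks k ∘ does⇒ (frac? (x′ k)))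
                          j (¬frac′ ∘ does⇒ (frac? (x′ j))) (⇒does (frac? (x j)) (z≢0⇒fractional j zj≢0))

        support-shrinks : ∀ v i → support x′ v i ℕ.≤ support x v i
        support-shrinks v i = countFin-mono λ e → T-∧-monoʳ (incident v e)
          (⇒does (pos? (x (combine e i))) ∘ positive-shrinks (combine e i) ∘ does⇒ (pos? (x′ (combine e i))))

        controlled′ : Controlled x′
        controlled′ v i with R <? deficit x v i | ctrl v i
        ... | _       | inj₂ supp≤ = inj₂ (ℚ.≤-trans (fromℕ-mono-≤ (support-shrinks v i)) supp≤)
        ... | yes R<d | inj₁ load≤ = inj₁ (ℚ.≤-trans (ℚ.≤-reflexive load-unchanged) load≤)
          where
          load-unchanged : load x′ v i ≡ load x v i
          load-unchanged = trans (sym (·-loadForm v i x′))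
            (preserved (loadForm (combine v i)) (·-loadForm v i x) (trans (·-loadForm v i z) (load-z≡0 v i R<d)))
        ... | no  R≮d | inj₁ load≤ = inj₂ (ℚ.≤-trans (fromℕ-mono-≤ (support-shrinks v i))
          (ℚ.≤-trans (ℚ.≤-reflexive (support≡load+deficit (inUnit fx) v i)) (ℚ.+-mono-≤ load≤ (ℚ.≮⇒≥ R≮d))))

    roundingStep : ∀ {x} → FractionalColouring x → Controlled x → ∀ {j₀} → Frac (x j₀) →
                   ∃ λ x′ → FractionalColouring x′ × Controlled x′ × fractionalEntries x′ ℕ.< fractionalEntries x
    roundingStep {x} fx ctrl frac₀ =
      let z , z⊥ , nontrivial = nontrivialKernel (constraints x) (fewerConstraintsThanEntries fx frac₀)
          open KernelStep fx ctrl z z⊥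
          t , x′∈[0,1] , j , zj≢0 , ¬frac′ = moveToBoundary x z (inUnit fx) z≢0⇒fractional nontrivial
          open Shift t
      in x′ , fractional′ x′∈[0,1] , controlled′ , fewerFractional j zj≢0 ¬frac′

    roundToIntegral : ∀ x → Acc ℕ._<_ (fractionalEntries x) → FractionalColouring x → Controlled x →
                      ∃ λ x′ → FractionalColouring x′ × Controlled x′ × (∀ j → ¬ Frac (x′ j))
    roundToIntegral x (acc rec) fx ctrl with any? (frac? ∘ x)
    ... | no  none         = x , fx , ctrl , λ j frac → none (j , frac)
    ... | yes (j₀ , frac₀) =
      let x′ , fx′ , ctrl′ , fewer = roundingStep fx ctrl frac₀ in roundToIntegral x′ (rec fewer) fx′ ctrl′

    integral-support≤ : ∀ {x} → FractionalColouring x → Controlled x → (∀ j → ¬ Frac (x j)) →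
                        ∀ v i → fromℕ (support x v i) ≤ load x₀ v i + R
    integral-support≤ {x} fx ctrl integral v i with ctrl v i
    ... | inj₂ supp≤ = supp≤
    ... | inj₁ load≤ = begin
      fromℕ (support x v i)      ≡⟨ support≡load+deficit (inUnit fx) v i ⟩
      load x v i + deficit x v i ≡⟨ cong (load x v i +_) (∑-zero λ e → trans (cong (𝟙 (incident v e) *_) (gap-integral (combine e i)))
                                                                          (ℚ.*-zeroʳ (𝟙 (incident v e)))) ⟩
      load x v i + 0ℚ            ≤⟨ ℚ.+-mono-≤ load≤ (fromℕ-nonNeg (rank G)) ⟩
      load x₀ v i + R            ∎
      where
      open ℚ.≤-Reasoning
      gap-integral : ∀ j → gap (x j) ≡ 0ℚ
      gap-integral j rewrite dec-false (frac? (x j)) (integral j) = refl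

  roundFractional : ∀ x₀ → FractionalColouring x₀ →
                    ∃ λ (col : Fin m → Fin K) → ∀ v i → fromℕ (colourDegree G col v i) ≤ load x₀ v i + R
  roundFractional x₀ fx₀ =
    let x , fx , ctrl , integral = roundToIntegral x₀ (<-wellFounded _) fx₀ (λ _ _ → inj₁ ℚ.≤-refl)
        col = λ e → proj₁ (positiveEntry fx e)
        colour-positive : ∀ v i e → T (incident v e ∧ does (col e Fin.≟ i)) → T (incident v e ∧ does (pos? (x (combine e i))))
        colour-positive v i e = T-∧-monoʳ (incident v e) λ col≡i →
          ⇒does (pos? _) (subst (λ i → 0ℚ < x (combine e i)) (does⇒ (col e Fin.≟ i) col≡i) (proj₂ (positiveEntry fx e)))
    in col , λ v i → ℚ.≤-trans (fromℕ-mono-≤ (countFin-mono (colour-positive v i))) (integral-support≤ fx ctrl integral v i)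
    where open StartingFrom x₀

-- The uniform fractional colouring and the final arithmetic

module Uniform {n m : ℕ} (G : Hypergraph n m) (k : ℕ) where
  open Rounding G (suc k)

  K : ℚ
  K = fromℕ (suc k)

  instance
    K≢0 : NonZero K
    K≢0 = >-nonZero (fromℕ-suc-pos k)

  1/K : ℚ
  1/K = 1/ K

  1/K*K≡1 : 1/K * K ≡ 1ℚ
  1/K*K≡1 = ℚ.*-inverseˡ K

  uniform : Weights
  uniform _ = 1/K

  uniform-fractional : FractionalColouring uniform
  uniform-fractional = record
    { inUnit   = λ _ → ℚ.<⇒≤ 0<1/K , 1/K≤1
    ; rowSum≡1 = λ _ → trans (sum-replicate (suc k) {1/K}) (trans (sym (fromℕ*≡ℕ× (suc k) 1/K)) (trans (ℚ.*-comm K 1/K) 1/K*K≡1))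
    }
    where
    0<1/K : 0ℚ < 1/K
    0<1/K = 0<1/ (fromℕ-suc-pos k)
    1/K≤1 : 1/K ≤ 1ℚ
    1/K≤1 = subst₂ _≤_ (ℚ.*-identityʳ 1/K) 1/K*K≡1
              (ℚ.*-monoˡ-≤-nonNeg 1/K {{nonNegative (ℚ.<⇒≤ 0<1/K)}} (fromℕ-mono-≤ {1} {suc k} (ℕ.s≤s ℕ.z≤n)))

  load-uniform : ∀ v i → load uniform v i ≡ fromℕ (degree G v) * 1/K
  load-uniform v i = trans (sym (*-distribʳ-sum 1/K (λ e → 𝟙 (incident v e))))
                           (cong (_* 1/K) (sym (fromℕ-countFin (λ e → incident v e))))

  clearDenominator : ∀ c d → fromℕ c ≤ fromℕ d * 1/K + R → c ℕ.* suc k ℕ.≤ d ℕ.+ rank G ℕ.* suc k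
  clearDenominator c d c≤ = fromℕ-cancel-≤ (begin
    fromℕ (c ℕ.* suc k)            ≡⟨ ×1-homo-* c (suc k) ⟩
    fromℕ c * K                    ≤⟨ ℚ.*-monoʳ-≤-nonNeg K {{nonNegative (fromℕ-nonNeg (suc k))}} c≤ ⟩
    (fromℕ d * 1/K + R) * K        ≡⟨ solve 4 (λ d q r κ → (d :* q :+ r) :* κ := d :* (q :* κ) :+ r :* κ) refl (fromℕ d) 1/K R K ⟩
    fromℕ d * (1/K * K) + R * K    ≡⟨ cong (λ u → fromℕ d * u + R * K) 1/K*K≡1 ⟩
    fromℕ d * 1ℚ + R * K           ≡⟨ cong (_+ R * K) (ℚ.*-identityʳ (fromℕ d)) ⟩
    fromℕ d + R * K                ≡⟨ sym (trans (×-homo-+ 1ℚ d _) (cong (fromℕ d +_) (×1-homo-* (rank G) (suc k)))) ⟩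
    fromℕ (d ℕ.+ rank G ℕ.* suc k) ∎)
    where
    open ℚ.≤-Reasoning
    open +-*-Solver

majority-arithmetic : ∀ k .{{_ : ℕ.NonZero k}} c d r →
                      c ℕ.* suc k ℕ.≤ d ℕ.+ r ℕ.* suc k → 2 ℕ.* r ℕ.* k ℕ.* k ℕ.≤ d → c ℕ.≤ d ℕ./ k
majority-arithmetic k c d r cK≤ 2rk²≤d = begin
  c             ≡⟨ sym (m*n/n≡m c k) ⟩
  c ℕ.* k ℕ./ k ≤⟨ /-monoˡ-≤ k (ℕ.*-cancelʳ-≤ (c ℕ.* k) d (suc k) ckK≤dK) ⟩
  d ℕ./ k       ∎
  where
  open ℕ.≤-Reasoning
  open Data.Nat.Solver.+-*-Solver
  rKk≤2rk² : r ℕ.* suc k ℕ.* k ℕ.≤ 2 ℕ.* r ℕ.* k ℕ.* k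
  rKk≤2rk² = ℕ.≤-trans (ℕ.*-monoˡ-≤ k (ℕ.*-monoʳ-≤ r (ℕ.+-monoˡ-≤ k (ℕ.>-nonZero⁻¹ k))))
                       (ℕ.≤-reflexive (solve 2 (λ r k → r :* (k :+ k) :* k := con 2 :* r :* k :* k) refl r k))
  ckK≤dK : c ℕ.* k ℕ.* suc k ℕ.≤ d ℕ.* suc k
  ckK≤dK = begin
    c ℕ.* k ℕ.* suc k             ≡⟨ solve 2 (λ c k → c :* k :* (con 1 :+ k) := c :* (con 1 :+ k) :* k) refl c k ⟩
    c ℕ.* suc k ℕ.* k             ≤⟨ ℕ.*-monoˡ-≤ k cK≤ ⟩
    (d ℕ.+ r ℕ.* suc k) ℕ.* k     ≡⟨ solve 3 (λ d r k → (d :+ r :* (con 1 :+ k)) :* k := d :* k :+ r :* (con 1 :+ k) :* k) refl d r k ⟩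
    d ℕ.* k ℕ.+ r ℕ.* suc k ℕ.* k ≤⟨ ℕ.+-monoʳ-≤ (d ℕ.* k) (ℕ.≤-trans rKk≤2rk² 2rk²≤d) ⟩
    d ℕ.* k ℕ.+ d                 ≡⟨ solve 2 (λ d k → d :* k :+ d := d :* (con 1 :+ k)) refl d k ⟩
    d ℕ.* suc k                   ∎

theorem2 : (k : ℕ) .{{_ : ℕ.NonZero k}} → 2 ℕ.≤ k → (n m : ℕ) (G : Hypergraph n m) →
    MinDegreeAtLeast G (2 ℕ.* rank G ℕ.* k ℕ.* k) →
    Σ (Fin m → Fin (suc k)) (λ c → IsMajorityColouring k G c)
theorem2 k _ n m G δ≥2rk² =
  let col , colourDegree≤ = roundFractional uniform uniform-fractional
      cd = colourDegree G col
      cd≤ : ∀ v i → fromℕ (cd v i) ≤ fromℕ (degree G v) * 1/K + R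
      cd≤ v i = subst (fromℕ (cd v i) ≤_) (cong (_+ R) (load-uniform v i)) (colourDegree≤ v i)
  in col , λ v i → majority-arithmetic k (cd v i) (degree G v) (rank G)
                     (clearDenominator (cd v i) (degree G v) (cd≤ v i)) (δ≥2rk² v)
  where
  open Rounding G (suc k)
  open Uniform G k
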